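{- Let $\Sigma$ be a finite filtration-ready set of formulas and $\mathcal{M}^f$ the filtration of the canonical model through $\Sigma$. Then ${\to^f}\circ R^f_\Box\subseteq R^f_{\mathsf{Agt}}\circ{\to^f}$.
   Context: Fix a finite non-empty set of agents $\mathsf{Agt}$ and a countably infinite set $\mathsf{Prop}$. $\mathcal{L}_{\mathrm{DTDS}}$: $\varphi::=p\mid\neg\varphi\mid(\varphi\land\varphi)\mid\Box\varphi\mid[i]\varphi\mid[\mathsf{Agt}]\varphi\mid\mathsf{O}_i\varphi\mid\mathsf{X}\varphi\mid\mathsf{U}(\varphi,\varphi)$. $\mathsf{L}_{\mathrm{DTDS}}$ is the smallest set of formulas containing all instances (for all $i$) of: propositional tautologies; K,T,4,5 for $\Box,[i],[\mathsf{Agt}]$; K for $\mathsf{O}_i,\mathsf{X}$; $\Box\varphi\to[i]\varphi$; $\bigwedge_i\Diamond[i]\varphi_i\to\Diamond\bigwedge_i[i]\varphi_i$; $\bigwedge_i[i]\varphi_i\to[\mathsf{Agt}]\bigwedge_i\varphi_i$; $[\mathsf{Agt}]\mathsf{X}\varphi\to\mathsf{X}\Box\varphi$; $\Box\varphi\to\mathsf{O}_i\varphi$; $\mathsf{O}_i\varphi\to\neg\mathsf{O}_i\neg\varphi$; $\mathsf{O}_i\varphi\to\mathsf{O}_i[i]\varphi$; $\mathsf{O}_i\varphi\to\Box\mathsf{O}_i\varphi$; $\mathsf{X}\varphi\leftrightarrow\neg\mathsf{X}\neg\varphi$; $\mathsf{U}(\varphi,\psi)\leftrightarrow(\varphi\lor(\psi\land\mathsf{X}\mathsf{U}(\varphi,\psi)))$;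 closed under modus ponens, necessitation for $\Box,[\mathsf{Agt}],\mathsf{X},[i],\mathsf{O}_i$, and: from $\chi\to(\neg\varphi\land\mathsf{X}\chi)$ infer $\chi\to\neg\mathsf{U}(\varphi,\psi)$. Canonical model: $S^c$ = maximal $\mathsf{L}_{\mathrm{DTDS}}$-consistent sets; for $O\in\{\Box,[\mathsf{Agt}]\}\cup\{[i],\mathsf{O}_i\mid i\in\mathsf{Agt}\}$, $wR^c_Ov$ iff $\varphi\in v$ whenever $O\varphi\in w$; $w\to^cv$ iff $\varphi\in v$ whenever $\mathsf{X}\varphi\in w$. $\Sigma$ is filtration-ready if closed under subformulas; closed under $\dot\neg$ ($\dot\neg\neg\psi=\psi$, $\dot\neg\psi=\neg\psi$ otherwise); $\mathsf{U}(\alpha,\beta)\in\Sigma\Rightarrow\mathsf{X}\mathsf{U}(\alpha,\beta)\in\Sigma$; $\mathsf{O}_i\varphi\in\Sigma\Rightarrow[i]\varphi\in\Sigma$. Filtration $\mathcal{M}^f$: $\Sigma(w)=w\cap\Sigma$; $w\sim v$ iff $\Sigma(w)=\Sigma(v)$ and $\{\Sigma(x)\mid wR^c_\Box x\}=\{\Sigma(x)\mid vR^c_\Box x\}$; $|w|$ is the $\sim$-class of $w$ and $S^f$ the set of $\sim$-classes. For each operator $O$, $CR^e_OD$ iff there are $w\in C$, $v\in D$ with $wR^c_Ov$. $R^f_\Box=R^e_\Box$; $C\to^fD$ iff there are $w\in C,v\in D$ with $w\to^cv$; $R^f_{\mathsf{Agt}}$ and $R^f_{[i]}$ are the transitive closures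 of $R^e_{[\mathsf{Agt}]}$ and $R^e_{[i]}$; $R^f_{\mathsf{O}_i}=R^e_{\mathsf{O}_i}\circ R^f_{[i]}$. Composition: $x(R\circ R')y$ iff $xRz$ and $zR'y$ for some $z$. -}

module Defs where

open import Level using (Level; 0ℓ) renaming (suc to lsuc)
open import Data.Nat using (ℕ; zero; suc)
open import Data.Fin using (Fin)
open import Data.Fin.Base using () renaming (zero to fzero; suc to fsuc)
open import Data.Bool using (Bool; true; false; not; _∧_)
open import Data.List using (List; []; _∷_; map; allFin)
open import Data.List.Relation.Unary.All using (All)
open import Data.List.Membership.Propositional using () renaming (_∈_ to _∈L_)
open import Data.Product using (Σ; ∃; _×_; _,_)
open import Relation.Binary.PropositionalEquality using (_≡_)
open import Relation.Binary.Construct.Closure.Transitive using (TransClosure)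
open import Relation.Nullary using (¬_)

variable
  k : ℕ

Agt : ℕ → Set
Agt k = Fin (suc k)

data Fm (k : ℕ) : Set where
  var   : ℕ → Fm k
  ¬'_   : Fm k → Fm k
  _∧'_  : Fm k → Fm k → Fm k
  □     : Fm k → Fm k
  [_]   : Agt k → Fm k → Fm k
  [Agt] : Fm k → Fm k
  O     : Agt k → Fm k → Fm k
  X     : Fm k → Fm k
  U     : Fm k → Fm k → Fm k

infix  9 ¬'_
infixr 7 _∧'_
infixr 6 _∨'_
infixr 5 _⇒_
infix  4 _⇔_
infix  2 ⊢_

_∨'_ : Fm k → Fm k → Fm k
φ ∨' ψ = ¬' (¬' φ ∧' ¬' ψ)

_⇒_ : Fm k → Fm k → Fm k
φ ⇒ ψ = ¬' (φ ∧' ¬' ψ)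

_⇔_ : Fm k → Fm k → Fm k
φ ⇔ ψ = (φ ⇒ ψ) ∧' (ψ ⇒ φ)

⊤' : Fm k
⊤' = ¬' (var 0 ∧' ¬' var 0)

◇ : Fm k → Fm k
◇ φ = ¬' □ (¬' φ)

conj : List (Fm k) → Fm k
conj []       = ⊤'
conj (φ ∷ []) = φ
conj (φ ∷ ψs) = φ ∧' conj ψs

⋀ : (Agt k → Fm k) → Fm k
⋀ {k} f = conj (map f (allFin (suc k)))

-- Propositional tautologies: formulas true under every Boolean valuation
-- that treats propositional letters and all modal formulas as atoms.

eval : (Fm k → Bool) → Fm k → Bool
eval v (¬' φ)    = not (eval v φ)
eval v (φ ∧' ψ)  = eval v φ ∧ eval v ψ
eval v φ         = v φ

Tautology : Fm k → Set
Tautology φ = ∀ v → eval v φ ≡ true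

data S5Op (k : ℕ) : Set where
  opBox : S5Op k
  opAg  : Agt k → S5Op k
  opAgt : S5Op k

s5 : S5Op k → Fm k → Fm k
s5 opBox    = □
s5 (opAg i) = [ i ]
s5 opAgt    = [Agt]

data ⊢_ {k : ℕ} : Fm k → Set where
  taut     : ∀ {φ} → Tautology φ → ⊢ φ
  ax-K     : ∀ M φ ψ → ⊢ (s5 M (φ ⇒ ψ) ⇒ (s5 M φ ⇒ s5 M ψ))
  ax-T     : ∀ M φ → ⊢ (s5 M φ ⇒ φ)
  ax-4     : ∀ M φ → ⊢ (s5 M φ ⇒ s5 M (s5 M φ))
  ax-5     : ∀ M φ → ⊢ (¬' s5 M (¬' φ) ⇒ s5 M (¬' s5 M (¬' φ)))
  ax-KO    : ∀ i φ ψ → ⊢ (O i (φ ⇒ ψ) ⇒ (O i φ ⇒ O i ψ))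
  ax-KX    : ∀ φ ψ → ⊢ (X (φ ⇒ ψ) ⇒ (X φ ⇒ X ψ))
  ax-□i    : ∀ i φ → ⊢ (□ φ ⇒ [ i ] φ)
  ax-IA    : ∀ (φs : Agt k → Fm k) →
             ⊢ (⋀ (λ i → ◇ ([ i ] (φs i))) ⇒ ◇ (⋀ (λ i → [ i ] (φs i))))
  ax-Agt   : ∀ (φs : Agt k → Fm k) →
             ⊢ (⋀ (λ i → [ i ] (φs i)) ⇒ [Agt] (⋀ φs))
  ax-AgtX  : ∀ φ → ⊢ ([Agt] (X φ) ⇒ X (□ φ))
  ax-□O    : ∀ i φ → ⊢ (□ φ ⇒ O i φ)
  ax-DO    : ∀ i φ → ⊢ (O i φ ⇒ ¬' O i (¬' φ))
  ax-Oi    : ∀ i φ → ⊢ (O i φ ⇒ O i ([ i ] φ))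
  ax-O□    : ∀ i φ → ⊢ (O i φ ⇒ □ (O i φ))
  ax-X     : ∀ φ → ⊢ (X φ ⇔ ¬' X (¬' φ))
  ax-U     : ∀ φ ψ → ⊢ (U φ ψ ⇔ (φ ∨' (ψ ∧' X (U φ ψ))))
  mp       : ∀ {φ ψ} → ⊢ (φ ⇒ ψ) → ⊢ φ → ⊢ ψ
  nec-S5   : ∀ M {φ} → ⊢ φ → ⊢ s5 M φ
  nec-O    : ∀ i {φ} → ⊢ φ → ⊢ O i φ
  nec-X    : ∀ {φ} → ⊢ φ → ⊢ X φ
  ind-U    : ∀ {χ φ ψ} → ⊢ (χ ⇒ (¬' φ ∧' X χ)) → ⊢ (χ ⇒ ¬' U φ ψ)

FmSet : ℕ → Set₁
FmSet k = Fm k → Set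

_⊆_ : FmSet k → FmSet k → Set
Γ ⊆ Δ = ∀ φ → Γ φ → Δ φ

Consistent : FmSet k → Set
Consistent Γ = ∀ (L : List (Fm _)) → All Γ L → ¬ (⊢ ¬' conj L)

MaxConsistent : FmSet k → Set₁
MaxConsistent {k} Γ = Consistent Γ × (∀ (Δ : FmSet k) → Consistent Δ → Γ ⊆ Δ → Δ ⊆ Γ)

record MCS (k : ℕ) : Set₁ where
  constructor mcs
  field
    set   : FmSet k
    isMax : MaxConsistent set
open MCS public

_∋_ : MCS k → Fm k → Set
w ∋ φ = set w φ

data Op (k : ℕ) : Set where
  opBox  : Op k
  opAgt  : Op k
  opAg   : Agt k → Op k
  opO    : Agt k → Op k
  opNext : Op k

apply : Op k → Fm k → Fm k
apply opBox    = □
apply opAgt    = [Agt]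
apply (opAg i) = [ i ]
apply (opO i)  = O i
apply opNext   = X

Rc : Op k → MCS k → MCS k → Set
Rc o w v = ∀ φ → w ∋ apply o φ → v ∋ φ

data ImmSub {k : ℕ} : Fm k → Fm k → Set where
  s-¬   : ∀ {φ} → ImmSub φ (¬' φ)
  s-∧l  : ∀ {φ ψ} → ImmSub φ (φ ∧' ψ)
  s-∧r  : ∀ {φ ψ} → ImmSub ψ (φ ∧' ψ)
  s-□   : ∀ {φ} → ImmSub φ (□ φ)
  s-i   : ∀ {i φ} → ImmSub φ ([ i ] φ)
  s-Agt : ∀ {φ} → ImmSub φ ([Agt] φ)
  s-O   : ∀ {i φ} → ImmSub φ (O i φ)
  s-X   : ∀ {φ} → ImmSub φ (X φ)
  s-Ul  : ∀ {φ ψ} → ImmSub φ (U φ ψ)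
  s-Ur  : ∀ {φ ψ} → ImmSub ψ (U φ ψ)

¬̇ : Fm k → Fm k
¬̇ (¬' ψ) = ψ
¬̇ ψ      = ¬' ψ

record FiltrationReady {k : ℕ} (Sg : List (Fm k)) : Set where
  field
    subClosed : ∀ {φ ψ} → φ ∈L Sg → ImmSub ψ φ → ψ ∈L Sg
    negClosed : ∀ {φ} → φ ∈L Sg → ¬̇ φ ∈L Sg
    UClosed   : ∀ {α β} → U α β ∈L Sg → X (U α β) ∈L Sg
    OClosed   : ∀ {i φ} → O i φ ∈L Sg → [ i ] φ ∈L Sg

-- The filtration M^f through Σ.  Equivalence classes |w| are represented
-- by their members; all relations below are ∼-invariant by construction.

SameΣ : List (Fm k) → MCS k → MCS k → Set
SameΣ Sg w v = ∀ φ → φ ∈L Sg → (w ∋ φ → v ∋ φ) × (v ∋ φ → w ∋ φ)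

_∼⟨_⟩_ : MCS k → List (Fm k) → MCS k → Set₁
w ∼⟨ Sg ⟩ v =
  SameΣ Sg w v
  × (∀ x → Rc opBox w x → Σ (MCS _) λ y → Rc opBox v y × SameΣ Sg x y)
  × (∀ y → Rc opBox v y → Σ (MCS _) λ x → Rc opBox w x × SameΣ Sg x y)

Re : List (Fm k) → Op k → MCS k → MCS k → Set₁
Re {k} Sg o w v =
  Σ (MCS k) λ w' → Σ (MCS k) λ v' → w ∼⟨ Sg ⟩ w' × v ∼⟨ Sg ⟩ v' × Rc o w' v'

Rf-□ : List (Fm k) → MCS k → MCS k → Set₁
Rf-□ Sg = Re Sg opBox

Nextf : List (Fm k) → MCS k → MCS k → Set₁
Nextf Sg = Re Sg opNext

Rf-Agt : List (Fm k) → MCS k → MCS k → Set₁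
Rf-Agt Sg = TransClosure (Re Sg opAgt)

Rf-i : List (Fm k) → Agt k → MCS k → MCS k → Set₁
Rf-i Sg i = TransClosure (Re Sg (opAg i))

_⨾_ : (MCS k → MCS k → Set₁) → (MCS k → MCS k → Set₁) → MCS k → MCS k → Set₁
_⨾_ {k} R R' x y = Σ (MCS k) λ z → R x z × R' z y

Rf-O : List (Fm k) → Agt k → MCS k → MCS k → Set₁
Rf-O Sg i = Re Sg (opO i) ⨾ Rf-i Sg i

_⊆R_ : (MCS k → MCS k → Set₁) → (MCS k → MCS k → Set₁) → Set₁
_⊆R_ {k} R R' = ∀ (x y : MCS k) → R x y → R' x y

{-# OPTIONS --safe #-}

-- Let |x| →f |z| R□f |y| be witnessed by x₁ →c z₁ and z₂ R□c y₂, where z₁ ∼ z ∼ z₂ and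
-- y ∼ y₂.  Since ∼ also compares the Σ-types of □-successors and R□c is an equivalence
-- relation, z₁ has a □-successor y₁ ∼ y.  In the canonical model →c ∘ R□c ⊆ R[Agt]c ∘ →c:
-- by the axiom [Agt]Xφ → X□φ the set {φ | [Agt]φ ∈ x₁} ∪ {Xψ | ψ ∈ y₁} is consistent, and
-- any maximal consistent extension w (Lindenbaum's lemma, where excluded middle is used)
-- satisfies x₁ R[Agt]c w →c y₁.  Hence |x| R[Agt]f |w| →f |y|.

module Submission where

open import Defs
open import Level using (0ℓ; lift; lower) renaming (suc to lsuc)
open import Axiom.ExcludedMiddle using (ExcludedMiddle)
open import Data.Nat using (ℕ; zero; suc; _≤_; _≤′_; ≤′-refl; ≤′-step; _⊔_)
open import Data.Nat.Properties using (≤⇒≤′; m≤m⊔n; m≤n⊔m)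
open import Data.Fin using (Fin) renaming (zero to fzero; suc to fsuc)
open import Data.Bool using (Bool; true; false; not; _∧_; T)
open import Data.Bool.Properties using (T-∧; T-≡)
open import Data.Vec using (Vec; []; _∷_; lookup) renaming (map to mapᵥ)
open import Data.Vec.Properties using (lookup-map)
open import Data.List using (List; []; _∷_; _++_; map; allFin; cartesianProductWith)
open import Data.List.Relation.Unary.All using (All; []; _∷_)
import Data.List.Relation.Unary.All as All
import Data.List.Relation.Unary.All.Properties as All
open import Data.List.Relation.Unary.Any using (here; there)
open import Data.List.Membership.Propositional using (_∈_)
open import Data.List.Membership.Propositional.Properties
  using (∈-++⁺ˡ; ∈-++⁺ʳ; ∈-map⁺; ∈-allFin; ∈-cartesianProductWith⁺)
open import Data.Product using (Σ; ∃; _×_; _,_; proj₁; proj₂)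
open import Data.Sum using (_⊎_; inj₁; inj₂; [_,_]′)
import Data.Sum as Sum
open import Data.Empty using (⊥-elim)
open import Function using (_∘_; _$_)
open import Function.Bundles using (Equivalence)
open import Relation.Nullary using (¬_; Dec; yes; no)
open import Relation.Nullary.Decidable using (map′)
open import Relation.Unary using (_∪_; ｛_｝; ⋃)
open import Relation.Binary.PropositionalEquality using (_≡_; refl; sym; trans; cong; cong₂)
open import Relation.Binary.Construct.Closure.Transitive using ([_])
open import Relation.Binary.Bundles using (Setoid)
import Relation.Binary.Reasoning.Setoid as SetoidReasoning

private
  variable
    κ n : ℕ
    φ ψ χ θ : Fm κ
    L M N : List (Fm κ)

-- Propositional reasoning

data Schema (n : ℕ) : Set where
  atom : Fin n → Schema n
  ~_   : Schema n → Schema n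
  _&_  : Schema n → Schema n → Schema n

infix  9 ~_
infixr 7 _&_
infixr 5 _⊃_

_⊃_ : Schema n → Schema n → Schema n
s ⊃ t = ~ (s & ~ t)

A : Schema (suc n)
A = atom fzero

B : Schema (suc (suc n))
B = atom (fsuc fzero)

C : Schema (suc (suc (suc n)))
C = atom (fsuc (fsuc fzero))

D : Schema (suc (suc (suc (suc n))))
D = atom (fsuc (fsuc (fsuc fzero)))

instantiate : Schema n → Vec (Fm κ) n → Fm κ
instantiate (atom i) ρ = lookup ρ i
instantiate (~ s)    ρ = ¬' instantiate s ρ
instantiate (s & t)  ρ = instantiate s ρ ∧' instantiate t ρ

truth : Schema n → Vec Bool n → Bool
truth (atom i) bs = lookup bs i
truth (~ s)    bs = not (truth s bs)
truth (s & t)  bs = truth s bs ∧ truth t bs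

valid : ∀ n → (Vec Bool n → Bool) → Bool
valid zero    f = f []
valid (suc n) f = valid n (f ∘ (true ∷_)) ∧ valid n (f ∘ (false ∷_))

valid-sound : ∀ n f → T (valid n f) → ∀ bs → T (f bs)
valid-sound zero    f v []           = v
valid-sound (suc n) f v (true ∷ bs)  = valid-sound n _ (proj₁ (Equivalence.to T-∧ v)) bs
valid-sound (suc n) f v (false ∷ bs) = valid-sound n _ (proj₂ (Equivalence.to T-∧ v)) bs

eval-instantiate : ∀ (s : Schema n) (ρ : Vec (Fm κ) n) v →
                   eval v (instantiate s ρ) ≡ truth s (mapᵥ (eval v) ρ)
eval-instantiate (atom i) ρ v = sym (lookup-map i (eval v) ρ)
eval-instantiate (~ s)    ρ v = cong not (eval-instantiate s ρ v)
eval-instantiate (s & t)  ρ v = cong₂ _∧_ (eval-instantiate s ρ v) (eval-instantiate t ρ v)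

-- The implicit argument reduces to ⊤, and is thus filled in, exactly when the truth
-- table of the schema evaluates to true everywhere.
tautology : (ρ : Vec (Fm κ) n) (s : Schema n) → {T (valid n (truth s))} → ⊢ instantiate s ρ
tautology {n = n} ρ s {v} = taut λ val →
  trans (eval-instantiate s ρ val) (Equivalence.to T-≡ (valid-sound n (truth s) v _))

⇒-refl : ⊢ φ ⇒ φ
⇒-refl {φ = φ} = tautology (φ ∷ []) (A ⊃ A)

⇒-trans : ⊢ φ ⇒ ψ → ⊢ ψ ⇒ χ → ⊢ φ ⇒ χ
⇒-trans {φ = φ} {ψ} {χ} = mp ∘ mp (tautology (φ ∷ ψ ∷ χ ∷ []) ((A ⊃ B) ⊃ (B ⊃ C) ⊃ (A ⊃ C)))

⇒-const : ⊢ φ → ⊢ ψ ⇒ φ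
⇒-const {φ = φ} {ψ} = mp (tautology (φ ∷ ψ ∷ []) (A ⊃ B ⊃ A))

⊤-intro : ⊢ ⊤' {κ}
⊤-intro = tautology (var 0 ∷ []) (~ (A & ~ A))

∧-intro : ⊢ χ ⇒ φ → ⊢ χ ⇒ ψ → ⊢ χ ⇒ φ ∧' ψ
∧-intro {χ = χ} {φ} {ψ} = mp ∘ mp (tautology (φ ∷ ψ ∷ χ ∷ []) ((C ⊃ A) ⊃ (C ⊃ B) ⊃ (C ⊃ A & B)))

∧-elimˡ : ⊢ φ ∧' ψ ⇒ φ
∧-elimˡ {φ = φ} {ψ} = tautology (φ ∷ ψ ∷ []) (A & B ⊃ A)

∧-elimʳ : ⊢ φ ∧' ψ ⇒ ψ
∧-elimʳ {φ = φ} {ψ} = tautology (φ ∷ ψ ∷ []) (A & B ⊃ B)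

∧-mono : ⊢ φ ⇒ ψ → ⊢ χ ⇒ θ → ⊢ φ ∧' χ ⇒ ψ ∧' θ
∧-mono {φ = φ} {ψ} {χ} {θ} =
  mp ∘ mp (tautology (φ ∷ ψ ∷ χ ∷ θ ∷ []) ((A ⊃ B) ⊃ (C ⊃ D) ⊃ (A & C ⊃ B & D)))

∧-uncurry : ⊢ φ ⇒ ψ ⇒ χ → ⊢ φ ∧' ψ ⇒ χ
∧-uncurry {φ = φ} {ψ} {χ} = mp (tautology (φ ∷ ψ ∷ χ ∷ []) ((A ⊃ B ⊃ C) ⊃ (A & B ⊃ C)))

contraposition : ⊢ φ ⇒ ψ → ⊢ ¬' ψ ⇒ ¬' φ
contraposition {φ = φ} {ψ} = mp (tautology (φ ∷ ψ ∷ []) ((A ⊃ B) ⊃ (~ B ⊃ ~ A)))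

modus-tollens : ⊢ φ ⇒ ψ → ⊢ ¬' ψ → ⊢ ¬' φ
modus-tollens = mp ∘ contraposition

¬¬-intro : ⊢ φ ⇒ ¬' ¬' φ
¬¬-intro {φ = φ} = tautology (φ ∷ []) (A ⊃ ~ ~ A)

¬¬-elim : ⊢ ¬' ¬' φ ⇒ φ
¬¬-elim {φ = φ} = tautology (φ ∷ []) (~ ~ A ⊃ A)

¬∧⇒⇒¬ : ⊢ ¬' (φ ∧' ψ) → ⊢ φ ⇒ ¬' ψ
¬∧⇒⇒¬ {φ = φ} {ψ} = mp (tautology (φ ∷ ψ ∷ []) (~ (A & B) ⊃ (A ⊃ ~ B)))

⇔-to : ⊢ φ ⇔ ψ → ⊢ φ ⇒ ψ
⇔-to = mp ∧-elimˡ

⇔-from : ⊢ φ ⇔ ψ → ⊢ ψ ⇒ φ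
⇔-from = mp ∧-elimʳ

conj-∷⁻ : ∀ (φ : Fm κ) L → ⊢ conj (φ ∷ L) ⇒ φ ∧' conj L
conj-∷⁻ φ []      = ∧-intro ⇒-refl (⇒-const ⊤-intro)
conj-∷⁻ φ (_ ∷ _) = ⇒-refl

conj-∷⁺ : ∀ (φ : Fm κ) L → ⊢ φ ∧' conj L ⇒ conj (φ ∷ L)
conj-∷⁺ φ []      = ∧-elimˡ
conj-∷⁺ φ (_ ∷ _) = ⇒-refl

conj-∈ : φ ∈ L → ⊢ conj L ⇒ φ
conj-∈ {L = ψ ∷ L} (here refl) = ⇒-trans (conj-∷⁻ ψ L) ∧-elimˡ
conj-∈ {L = ψ ∷ L} (there p)   = ⇒-trans (conj-∷⁻ ψ L) (⇒-trans ∧-elimʳ (conj-∈ p))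

conj-intro : All (λ ψ → ⊢ χ ⇒ ψ) L → ⊢ χ ⇒ conj L
conj-intro []                   = ⇒-const ⊤-intro
conj-intro {L = ψ ∷ L} (h ∷ hs) = ⇒-trans (∧-intro h (conj-intro hs)) (conj-∷⁺ ψ L)

conj-⊇ : ∀ L M → (∀ {ψ : Fm κ} → ψ ∈ M → ψ ∈ L) → ⊢ conj L ⇒ conj M
conj-⊇ L M M⊆L = conj-intro (All.tabulate (conj-∈ ∘ M⊆L))

conj-++ : ∀ (L M : List (Fm κ)) → ⊢ conj (L ++ M) ⇒ conj L ∧' conj M
conj-++ L M = ∧-intro (conj-⊇ (L ++ M) L ∈-++⁺ˡ) (conj-⊇ (L ++ M) M (∈-++⁺ʳ L))

record IsNormal (f : Fm κ → Fm κ) : Set where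
  field
    nec : ⊢ φ → ⊢ f φ
    K   : ∀ φ ψ → ⊢ f (φ ⇒ ψ) ⇒ (f φ ⇒ f ψ)

  mono : ⊢ φ ⇒ ψ → ⊢ f φ ⇒ f ψ
  mono {φ} {ψ} = mp (K φ ψ) ∘ nec

  distrib-∧ : ⊢ f φ ∧' f ψ ⇒ f (φ ∧' ψ)
  distrib-∧ {φ} {ψ} =
    ∧-uncurry (⇒-trans (mono (tautology (φ ∷ ψ ∷ []) (A ⊃ B ⊃ A & B))) (K ψ (φ ∧' ψ)))

  distrib-conj : ∀ L → ⊢ conj (map f L) ⇒ f (conj L)
  distrib-conj []      = ⇒-const (nec ⊤-intro)
  distrib-conj (φ ∷ L) =
    ⇒-trans (conj-∷⁻ (f φ) (map f L))
      (⇒-trans (∧-mono ⇒-refl (distrib-conj L)) (⇒-trans distrib-∧ (mono (conj-∷⁺ φ L))))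

  distrib-conj⁻ : ∀ L → ⊢ f (conj L) ⇒ conj (map f L)
  distrib-conj⁻ L = conj-intro (All.map⁺ {xs = L} (All.tabulate (mono ∘ conj-∈)))

□-normal : IsNormal {κ} □
□-normal = record { nec = nec-S5 opBox ; K = ax-K opBox }

[Agt]-normal : IsNormal {κ} [Agt]
[Agt]-normal = record { nec = nec-S5 opAgt ; K = ax-K opAgt }

X-normal : IsNormal {κ} X
X-normal = record { nec = nec-X ; K = ax-KX }

¬X⇒X¬ : ⊢ ¬' X φ ⇒ X (¬' φ)
¬X⇒X¬ {φ = φ} = ⇒-trans (contraposition (⇔-from (ax-X φ))) ¬¬-elim

-- Maximal consistent sets

All-∪-split : ∀ {A : Set} {P Q : A → Set} (N : List A) → All (P ∪ Q) N →
              Σ (List A) λ L → Σ (List A) λ M →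
                All P L × All Q M × (∀ {a} → a ∈ N → a ∈ L ⊎ a ∈ M)
All-∪-split [] [] = [] , [] , [] , [] , λ ()
All-∪-split (a ∷ N) (pq ∷ pqs) with All-∪-split N pqs | pq
... | L , M , ps , qs , N⊆ | inj₁ p =
  a ∷ L , M , p ∷ ps , qs , λ { (here refl) → inj₁ (here refl) ; (there a∈) → Sum.map₁ there (N⊆ a∈) }
... | L , M , ps , qs , N⊆ | inj₂ q =
  L , a ∷ M , ps , q ∷ qs , λ { (here refl) → inj₂ (here refl) ; (there a∈) → Sum.map₂ there (N⊆ a∈) }

conj-∪ : (∀ {ψ} → ψ ∈ N → ψ ∈ L ⊎ ψ ∈ M) → ⊢ conj L ∧' conj M ⇒ conj N
conj-∪ N⊆ = conj-intro (All.tabulate λ ψ∈ →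
  [ (λ ψ∈L → ⇒-trans ∧-elimˡ (conj-∈ ψ∈L)) , (λ ψ∈M → ⇒-trans ∧-elimʳ (conj-∈ ψ∈M)) ]′ (N⊆ ψ∈))

conj-｛｝ : All ｛ φ ｝ M → ⊢ φ ⇒ conj M
conj-｛｝ = conj-intro ∘ All.map λ { refl → ⇒-refl }

consistent-⊆ : {Γ Δ : FmSet κ} → Γ ⊆ Δ → Consistent Δ → Consistent Γ
consistent-⊆ Γ⊆Δ Δ-con L ps = Δ-con L (All.map (Γ⊆Δ _) ps)

consistent-∪ : {Γ Δ : FmSet κ} →
               (∀ L M → All Γ L → All Δ M → ¬ (⊢ ¬' (conj L ∧' conj M))) → Consistent (Γ ∪ Δ)
consistent-∪ h N ps ⊢¬N with All-∪-split N ps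
... | L , M , qs , rs , N⊆ = h L M qs rs (modus-tollens (conj-∪ N⊆) ⊢¬N)

∋-consistent : ∀ (w : MCS κ) → Consistent (set w)
∋-consistent w = proj₁ (isMax w)

∋-if-consistent : ∀ (w : MCS κ) → Consistent (set w ∪ ｛ φ ｝) → w ∋ φ
∋-if-consistent w con = proj₂ (isMax w) _ con (λ _ → inj₁) _ (inj₂ refl)

∋-closed : ∀ (w : MCS κ) → All (set w) L → ⊢ conj L ⇒ φ → w ∋ φ
∋-closed {L = L} w ps L⇒φ = ∋-if-consistent w $ consistent-∪ λ L′ M ps′ qs ⊢¬ →
  ∋-consistent w (L′ ++ L) (All.++⁺ ps′ ps)
    (modus-tollens (⇒-trans (conj-++ L′ L) (∧-mono ⇒-refl (⇒-trans L⇒φ (conj-｛｝ qs)))) ⊢¬)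

∋-mp : ∀ (w : MCS κ) → w ∋ φ → ⊢ φ ⇒ ψ → w ∋ ψ
∋-mp w φ∈w = ∋-closed w (φ∈w ∷ [])

∋-conj : ∀ (w : MCS κ) → All (set w) L → w ∋ conj L
∋-conj w ps = ∋-closed w ps ⇒-refl

∋-¬ : ∀ (w : MCS κ) → w ∋ φ → ¬ (w ∋ (¬' φ))
∋-¬ {φ = φ} w φ∈w ¬φ∈w =
  ∋-consistent w (φ ∷ ¬' φ ∷ []) (φ∈w ∷ ¬φ∈w ∷ []) (tautology (φ ∷ []) (~ (A & ~ A)))

∌⇒∋¬ : ∀ (w : MCS κ) → ¬ (w ∋ φ) → w ∋ (¬' φ)
∌⇒∋¬ w φ∉w = ∋-if-consistent w $ consistent-∪ λ L M ps qs ⊢¬ →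
  φ∉w (∋-closed w ps (modus-tollens (∧-mono ⇒-refl (conj-｛｝ qs)) ⊢¬))

-- Lindenbaum's lemma

ascending-mono : (F : ℕ → FmSet κ) → (∀ n → F n ⊆ F (suc n)) → ∀ {m n} → m ≤ n → F m ⊆ F n
ascending-mono F step {m} m≤n = go (≤⇒≤′ m≤n)
  where
  go : ∀ {n} → m ≤′ n → F m ⊆ F n
  go ≤′-refl        φ p = p
  go (≤′-step m≤′n) φ p = step _ φ (go m≤′n φ p)

All-⋃-ascending : (F : ℕ → FmSet κ) → (∀ n → F n ⊆ F (suc n)) →
                  All (⋃ ℕ F) L → ∃ λ n → All (F n) L
All-⋃-ascending F step [] = 0 , []
All-⋃-ascending F step ((m , p) ∷ ps) with All-⋃-ascending F step ps
... | n , qs =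
  m ⊔ n , ascending-mono F step (m≤m⊔n m n) _ p ∷ All.map (ascending-mono F step (m≤n⊔m m n) _) qs

applications : {A B : Set} → List (A → B) → List A → List B
applications = cartesianProductWith λ f a → f a

∈-applications : {A B : Set} {f : A → B} {fs : List (A → B)} {a : A} {as : List A} →
                 f ∈ fs → a ∈ as → f a ∈ applications fs as
∈-applications = ∈-cartesianProductWith⁺ λ f a → f a

unaryOps : List (Fm κ → Fm κ)
unaryOps = ¬'_ ∷ □ ∷ [Agt] ∷ X ∷ map [_] (allFin _) ++ map O (allFin _)

binaryOps : List (Fm κ → Fm κ → Fm κ)
binaryOps = _∧'_ ∷ U ∷ []

formulas : ℕ → List (Fm κ)
formulas zero    = []
formulas (suc n) = var n ∷ Φ ++ applications unaryOps Φ ++ applications (applications binaryOps Φ) Φ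
  where Φ = formulas n

formulas-ascending : ∀ n → (_∈ formulas {κ} n) ⊆ (_∈ formulas (suc n))
formulas-ascending n φ = there ∘ ∈-++⁺ˡ

formulas-unary : ∀ {f : Fm κ → Fm κ} → f ∈ unaryOps →
                 ∃ (λ n → φ ∈ formulas n) → ∃ λ n → f φ ∈ formulas n
formulas-unary f∈ (n , φ∈) = suc n , there (∈-++⁺ʳ (formulas n) (∈-++⁺ˡ (∈-applications f∈ φ∈)))

formulas-binary : ∀ {f : Fm κ → Fm κ → Fm κ} → f ∈ binaryOps →
                  ∃ (λ n → φ ∈ formulas n) → ∃ (λ n → ψ ∈ formulas n) → ∃ λ n → f φ ψ ∈ formulas n
formulas-binary f∈ (m , φ∈) (n , ψ∈) =
  suc (m ⊔ n) , there (∈-++⁺ʳ (formulas (m ⊔ n)) (∈-++⁺ʳ (applications unaryOps (formulas (m ⊔ n)))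
    (∈-applications (∈-applications f∈ (formulas-mono (m≤m⊔n m n) _ φ∈)) (formulas-mono (m≤n⊔m m n) _ ψ∈))))
  where
  formulas-mono : ∀ {i j} → i ≤ j → (_∈ formulas i) ⊆ (_∈ formulas j)
  formulas-mono = ascending-mono (λ i → _∈ formulas i) formulas-ascending

formulas-complete : ∀ (φ : Fm κ) → ∃ λ n → φ ∈ formulas n
formulas-complete (var m)   = suc m , here refl
formulas-complete (¬' φ)    = formulas-unary (here refl) (formulas-complete φ)
formulas-complete (□ φ)     = formulas-unary (there (here refl)) (formulas-complete φ)
formulas-complete ([Agt] φ) = formulas-unary (there (there (here refl))) (formulas-complete φ)
formulas-complete (X φ)     = formulas-unary (there (there (there (here refl)))) (formulas-complete φ)
formulas-complete ([ i ] φ) =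
  formulas-unary (there (there (there (there (∈-++⁺ˡ (∈-map⁺ [_] (∈-allFin i)))))))
    (formulas-complete φ)
formulas-complete (O i φ)   =
  formulas-unary (there (there (there (there (∈-++⁺ʳ (map [_] (allFin _)) (∈-map⁺ O (∈-allFin i)))))))
    (formulas-complete φ)
formulas-complete (φ ∧' ψ)  = formulas-binary (here refl) (formulas-complete φ) (formulas-complete ψ)
formulas-complete (U φ ψ)   = formulas-binary (there (here refl)) (formulas-complete φ) (formulas-complete ψ)

module Classical (em : ExcludedMiddle (lsuc 0ℓ)) where

  decide : (P : Set) → Dec P
  decide P = map′ lower lift em

  ∋-complete : ∀ (w : MCS κ) φ → w ∋ φ ⊎ w ∋ (¬' φ)
  ∋-complete w φ with decide (w ∋ φ)
  ... | yes φ∈w = inj₁ φ∈w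
  ... | no  φ∉w = inj₂ (∌⇒∋¬ w φ∉w)

  addIfConsistent : FmSet κ → Fm κ → FmSet κ
  addIfConsistent Γ φ with decide (Consistent (Γ ∪ ｛ φ ｝))
  ... | yes _ = Γ ∪ ｛ φ ｝
  ... | no  _ = Γ

  addIfConsistent-⊇ : ∀ (Γ : FmSet κ) φ → Γ ⊆ addIfConsistent Γ φ
  addIfConsistent-⊇ Γ φ with decide (Consistent (Γ ∪ ｛ φ ｝))
  ... | yes _ = λ _ → inj₁
  ... | no  _ = λ _ p → p

  addIfConsistent-consistent : ∀ (Γ : FmSet κ) φ → Consistent Γ → Consistent (addIfConsistent Γ φ)
  addIfConsistent-consistent Γ φ Γ-con with decide (Consistent (Γ ∪ ｛ φ ｝))
  ... | yes Γφ-con = Γφ-con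
  ... | no  _      = Γ-con

  addIfConsistent-∋ : ∀ (Γ Δ : FmSet κ) φ → Consistent Δ → Γ ⊆ Δ → Δ φ → addIfConsistent Γ φ φ
  addIfConsistent-∋ Γ Δ φ Δ-con Γ⊆Δ φ∈Δ with decide (Consistent (Γ ∪ ｛ φ ｝))
  ... | yes _      = inj₂ refl
  ... | no  ¬Γφ-con =
    ⊥-elim (¬Γφ-con (consistent-⊆ (λ ψ → [ Γ⊆Δ ψ , (λ { refl → φ∈Δ }) ]′) Δ-con))

  addAll : List (Fm κ) → FmSet κ → FmSet κ
  addAll []      Γ = Γ
  addAll (φ ∷ L) Γ = addAll L (addIfConsistent Γ φ)

  addAll-⊇ : ∀ L (Γ : FmSet κ) → Γ ⊆ addAll L Γ
  addAll-⊇ []      Γ ψ p = p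
  addAll-⊇ (φ ∷ L) Γ ψ p = addAll-⊇ L _ ψ (addIfConsistent-⊇ Γ φ ψ p)

  addAll-consistent : ∀ L (Γ : FmSet κ) → Consistent Γ → Consistent (addAll L Γ)
  addAll-consistent []      Γ Γ-con = Γ-con
  addAll-consistent (φ ∷ L) Γ Γ-con = addAll-consistent L _ (addIfConsistent-consistent Γ φ Γ-con)

  addAll-∋ : ∀ L (Γ Δ : FmSet κ) → φ ∈ L → Consistent Δ → addAll L Γ ⊆ Δ → Δ φ → addAll L Γ φ
  addAll-∋ (φ ∷ L) Γ Δ (here refl) Δ-con ⊆Δ φ∈Δ =
    addAll-⊇ L _ φ (addIfConsistent-∋ Γ Δ φ Δ-con
      (λ ψ p → ⊆Δ ψ (addAll-⊇ L _ ψ (addIfConsistent-⊇ Γ φ ψ p))) φ∈Δ)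
  addAll-∋ (ψ ∷ L) Γ Δ (there φ∈L) Δ-con ⊆Δ φ∈Δ = addAll-∋ L _ Δ φ∈L Δ-con ⊆Δ φ∈Δ

  lindenbaum : (Γ : FmSet κ) → Consistent Γ → Σ (MCS κ) λ w → Γ ⊆ set w
  lindenbaum Γ Γ-con = mcs (⋃ ℕ chain) (consistent , maximal) , λ φ p → 0 , p
    where
    chain : ℕ → FmSet _
    chain zero    = Γ
    chain (suc n) = addAll (formulas n) (chain n)

    chain-consistent : ∀ n → Consistent (chain n)
    chain-consistent zero    = Γ-con
    chain-consistent (suc n) = addAll-consistent (formulas n) (chain n) (chain-consistent n)

    consistent : Consistent (⋃ ℕ chain)
    consistent L ps =
      let n , qs = All-⋃-ascending chain (λ n → addAll-⊇ (formulas n) (chain n)) ps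
      in chain-consistent n L qs

    maximal : ∀ Δ → Consistent Δ → ⋃ ℕ chain ⊆ Δ → Δ ⊆ ⋃ ℕ chain
    maximal Δ Δ-con ⊆Δ φ φ∈Δ =
      let n , φ∈ = formulas-complete φ
      in suc n , addAll-∋ (formulas n) (chain n) Δ φ∈ Δ-con (λ ψ p → ⊆Δ ψ (suc n , p)) φ∈Δ

-- The canonical model

R□-transitive : ∀ (w v u : MCS κ) → Rc opBox w v → Rc opBox v u → Rc opBox w u
R□-transitive w v u wRv vRu φ □φ∈w = vRu φ (wRv (□ φ) (∋-mp w □φ∈w (ax-4 opBox φ)))

X-image : MCS κ → FmSet κ
X-image y φ = ∃ λ ψ → φ ≡ X ψ × y ∋ ψ

All-X-image : ∀ (y : MCS κ) M → All (X-image y) M → ∃ λ L → All (set y) L × M ≡ map X L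
All-X-image y [] [] = [] , [] , refl
All-X-image y (_ ∷ M) ((ψ , refl , ψ∈y) ∷ qs) with All-X-image y M qs
... | L , ps , refl = ψ ∷ L , ψ∈y ∷ ps , refl

-- If the set were inconsistent, some [Agt]α ∈ x and β ∈ y would give ⊢ α → X¬β,
-- hence [Agt]α → X□¬β, so □¬β ∈ z and ¬β ∈ y.
[Agt]-preimage∪X-image-consistent : ∀ (x z y : MCS κ) → Rc opNext x z → Rc opBox z y →
                                    Consistent ((λ φ → x ∋ [Agt] φ) ∪ X-image y)
[Agt]-preimage∪X-image-consistent x z y x→z zRy =
  consistent-∪ λ La M ps qs → refute La ps (All-X-image y M qs)
  where
  open IsNormal [Agt]-normal using (distrib-conj) renaming (mono to [Agt]-mono)

  refute : ∀ La {M} → All (λ φ → x ∋ [Agt] φ) La → ∃ (λ Lb → All (set y) Lb × M ≡ map X Lb) →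
           ¬ (⊢ ¬' (conj La ∧' conj M))
  refute La ps (Lb , ps′ , refl) ⊢¬ = ∋-¬ y (∋-conj y ps′) (zRy _ (x→z _ X□¬β∈x))
    where
    α⇒X¬β : ⊢ conj La ⇒ X (¬' conj Lb)
    α⇒X¬β = ⇒-trans (¬∧⇒⇒¬ (modus-tollens (∧-mono ⇒-refl (IsNormal.distrib-conj⁻ X-normal Lb)) ⊢¬))
                    ¬X⇒X¬

    X□¬β∈x : x ∋ X (□ (¬' conj Lb))
    X□¬β∈x = ∋-closed x (All.map⁺ ps)
               (⇒-trans (distrib-conj La) (⇒-trans ([Agt]-mono α⇒X¬β) (ax-AgtX _)))

module Canonical (em : ExcludedMiddle (lsuc 0ℓ)) where

  open Classical em using (∋-complete; lindenbaum)

  R□-euclidean : ∀ (w v u : MCS κ) → Rc opBox w v → Rc opBox w u → Rc opBox v u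
  R□-euclidean w v u wRv wRu φ □φ∈v with ∋-complete w (□ φ)
  ... | inj₁ □φ∈w  = wRu φ □φ∈w
  ... | inj₂ ¬□φ∈w =
    ⊥-elim (∋-¬ v (∋-mp v □φ∈v (□-mono ¬¬-intro)) (wRv _ (∋-mp w ¬□φ∈w ¬□⇒□¬□¬¬)))
    where
    open IsNormal □-normal renaming (mono to □-mono)
    ¬□⇒□¬□¬¬ : ⊢ ¬' □ φ ⇒ □ (¬' □ (¬' ¬' φ))
    ¬□⇒□¬□¬¬ = ⇒-trans (contraposition (□-mono ¬¬-elim)) (ax-5 opBox (¬' φ))

  X-image-⊆⇒Rc-next : ∀ (w y : MCS κ) → X-image y ⊆ set w → Rc opNext w y
  X-image-⊆⇒Rc-next w y ⊆w φ Xφ∈w with ∋-complete y φ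
  ... | inj₁ φ∈y  = φ∈y
  ... | inj₂ ¬φ∈y = ⊥-elim (∋-¬ w (⊆w _ (¬' φ , refl , ¬φ∈y)) (∋-mp w Xφ∈w (⇔-to (ax-X φ))))

  Rc-next⨾box⊆agt⨾next : ∀ (x z y : MCS κ) → Rc opNext x z → Rc opBox z y →
                         Σ (MCS κ) λ w → Rc opAgt x w × Rc opNext w y
  Rc-next⨾box⊆agt⨾next x z y x→z zRy
    with lindenbaum _ ([Agt]-preimage∪X-image-consistent x z y x→z zRy)
  ... | w , ⊆w = w , (λ φ → ⊆w φ ∘ inj₁) , X-image-⊆⇒Rc-next w y (λ φ → ⊆w φ ∘ inj₂)

-- The filtration

module Filtration (em : ExcludedMiddle (lsuc 0ℓ)) {κ : ℕ} (Sg : List (Fm κ)) where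

  open Canonical em using (R□-euclidean)

  SameΣ-refl : ∀ (w : MCS κ) → SameΣ Sg w w
  SameΣ-refl w φ _ = (λ p → p) , (λ p → p)

  SameΣ-sym : ∀ (w v : MCS κ) → SameΣ Sg w v → SameΣ Sg v w
  SameΣ-sym w v w≈v φ φ∈Sg = proj₂ (w≈v φ φ∈Sg) , proj₁ (w≈v φ φ∈Sg)

  SameΣ-trans : ∀ (w v u : MCS κ) → SameΣ Sg w v → SameΣ Sg v u → SameΣ Sg w u
  SameΣ-trans w v u w≈v v≈u φ φ∈Sg =
    proj₁ (v≈u φ φ∈Sg) ∘ proj₁ (w≈v φ φ∈Sg) , proj₂ (w≈v φ φ∈Sg) ∘ proj₂ (v≈u φ φ∈Sg)

  _≲□_ : MCS κ → MCS κ → Set₁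
  w ≲□ v = ∀ x → Rc opBox w x → Σ (MCS κ) λ y → Rc opBox v y × SameΣ Sg x y

  _≃□_ : MCS κ → MCS κ → Set₁
  w ≃□ v = w ≲□ v × v ≲□ w

  ≲□-refl : ∀ w → w ≲□ w
  ≲□-refl w x wRx = x , wRx , SameΣ-refl x

  ≲□-trans : ∀ w v u → w ≲□ v → v ≲□ u → w ≲□ u
  ≲□-trans w v u w≲v v≲u x wRx =
    let y , vRy , x≈y = w≲v x wRx
        z , uRz , y≈z = v≲u y vRy
    in z , uRz , SameΣ-trans x y z x≈y y≈z

  ≃□-setoid : Setoid (lsuc 0ℓ) (lsuc 0ℓ)
  ≃□-setoid = record
    { Carrier       = MCS κ
    ; _≈_           = _≃□_
    ; isEquivalence = record
      { refl  = λ {w} → ≲□-refl w , ≲□-refl w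
      ; sym   = λ (w≲v , v≲w) → v≲w , w≲v
      ; trans = λ {w} {v} {u} (w≲v , v≲w) (v≲u , u≲v) →
                  ≲□-trans w v u w≲v v≲u , ≲□-trans u v w u≲v v≲w
      }
    }

  ∼⇒≃□ : ∀ w v → w ∼⟨ Sg ⟩ v → w ≃□ v
  ∼⇒≃□ w v (_ , w≲v , back) = w≲v , λ y vRy →
    let x , wRx , x≈y = back y vRy in x , wRx , SameΣ-sym x y x≈y

  ∼-intro : ∀ w v → SameΣ Sg w v → w ≃□ v → w ∼⟨ Sg ⟩ v
  ∼-intro w v w≈v (w≲v , v≲w) = w≈v , w≲v , λ y vRy →
    let x , wRx , y≈x = v≲w y vRy in x , wRx , SameΣ-sym y x y≈x

  ∼-refl : ∀ w → w ∼⟨ Sg ⟩ w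
  ∼-refl w = ∼-intro w w (SameΣ-refl w) (≲□-refl w , ≲□-refl w)

  R□⇒≃□ : ∀ w v → Rc opBox w v → w ≃□ v
  R□⇒≃□ w v wRv = (λ x wRx → x , R□-euclidean w v x wRv wRx , SameΣ-refl x)
                , (λ x vRx → x , R□-transitive w v x wRv vRx , SameΣ-refl x)

  Rf-□-lift : ∀ z z₁ y → z ∼⟨ Sg ⟩ z₁ → Rf-□ Sg z y →
              Σ (MCS κ) λ y₁ → Rc opBox z₁ y₁ × y ∼⟨ Sg ⟩ y₁
  Rf-□-lift z z₁ y z∼z₁ (z₂ , y₂ , z∼z₂ , y∼y₂ , z₂Ry₂) =
    let u  , zRu   , y₂≈u = proj₂ (∼⇒≃□ z z₂ z∼z₂) y₂ z₂Ry₂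
        y₁ , z₁Ry₁ , u≈y₁ = proj₁ (∼⇒≃□ z z₁ z∼z₁) u zRu
    in y₁ , z₁Ry₁ , ∼-intro y y₁
         (SameΣ-trans y y₂ y₁ (proj₁ y∼y₂) (SameΣ-trans y₂ u y₁ y₂≈u u≈y₁))
         (y≃□ y₁ z₁Ry₁)
    where
    open SetoidReasoning ≃□-setoid
    y≃□ : ∀ y₁ → Rc opBox z₁ y₁ → y ≃□ y₁
    y≃□ y₁ z₁Ry₁ = begin
      y  ≈⟨ ∼⇒≃□ y y₂ y∼y₂ ⟩
      y₂ ≈⟨ R□⇒≃□ z₂ y₂ z₂Ry₂ ⟨
      z₂ ≈⟨ ∼⇒≃□ z z₂ z∼z₂ ⟨
      z  ≈⟨ ∼⇒≃□ z z₁ z∼z₁ ⟩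
      z₁ ≈⟨ R□⇒≃□ z₁ y₁ z₁Ry₁ ⟩
      y₁ ∎

proposition13 : ∀ (k : ℕ) → ExcludedMiddle (lsuc 0ℓ) →
                (Sg : List (Fm k)) → FiltrationReady Sg →
                (Nextf Sg ⨾ Rf-□ Sg) ⊆R (Rf-Agt Sg ⨾ Nextf Sg)
proposition13 k em Sg _ x y (z , (x₁ , z₁ , x∼x₁ , z∼z₁ , x₁→z₁) , z□y) =
  let open Canonical em
      open Filtration em Sg
      y₁ , z₁Ry₁ , y∼y₁ = Rf-□-lift z z₁ y z∼z₁ z□y
      w  , x₁Rw  , w→y₁ = Rc-next⨾box⊆agt⨾next x₁ z₁ y₁ x₁→z₁ z₁Ry₁
  in w , [ x₁ , w , x∼x₁ , ∼-refl w , x₁Rw ] , (w , y₁ , ∼-refl w , y∼y₁ , w→y₁)
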